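{- (1) For every $r\in\mathbb{Z}$ there exists $l\le r$ such that $[l..r]$ is a stable segment. (2) For every $l\in\mathbb{Z}$ there exists $r\ge l$ such that $[l..r]$ is a stable segment.
   Context: Setting: $L\ge1$, $X=Y$ is a string of length $L$ over $\Sigma$, and $E_0=\{(i_1,j_1),\dots,(i_M,j_M)\}\subseteq[L]^2$ with $i_t>j_t$, $X[i_t]=Y[j_t]$, $i_1<\dots<i_M$, $j_1<\dots<j_M$. Extend $X,Y$ to strings indexed by $\mathbb{Z}$ by $X[i]=Y[i]=X[L]$ for $i>L$ and $X[i]=Y[i]=X[1]$ for $i<1$, and let the set of matched edges be $E=E_0\cup\{(i,i-1): i>L \text{ or } i\le 1\}$ (a non-intersecting matching; every edge $(I,J)$ has $I>J$). For integers $l\le r$, $[l..r]=\{l,\dots,r\}$ is a stable segment if for every matched edge $(I,J)\in E$ exactly one of the following holds: ($J<l$ and $I\le r$), or ($J\ge l$ and $I>r$). -}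

module Defs where

open import Data.Nat as ℕ using (ℕ)
open import Data.Fin as Fin using (Fin; toℕ)
open import Data.Integer as ℤ using (ℤ; +_; _-_; _≤_; _<_; _>_)
open import Data.Product using (Σ; ∃; _×_; _,_)
open import Data.Sum using (_⊎_)
open import Relation.Binary.PropositionalEquality using (_≡_)

-- Positions of [L] = {1..L} are represented by Fin L; p : Fin L stands for toℕ p + 1.
pos : {L : ℕ} → Fin L → ℤ
pos p = + (ℕ.suc (toℕ p))

record Setting (Sym : Set) : Set where
  field
    L       : ℕ
    L≥1     : 1 ℕ.≤ L
    X       : Fin L → Sym
    M       : ℕ
    i j     : Fin M → Fin L
    i>j     : ∀ t → j t Fin.< i t
    match   : ∀ t → X (i t) ≡ X (j t)          -- X[i_t] = Y[j_t] with Y = X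
    i-mono  : ∀ s t → s Fin.< t → i s Fin.< i t
    j-mono  : ∀ s t → s Fin.< t → j s Fin.< j t

module _ {Sym : Set} (S : Setting Sym) where
  open Setting S

  Edge : ℤ → ℤ → Set
  Edge I J = (∃ λ t → I ≡ pos (i t) × J ≡ pos (j t))
           ⊎ ((I > + L ⊎ I ≤ + 1) × J ≡ I - + 1)

  -- [l..r] (with l ≤ r) is stable if every matched edge (I,J) satisfies exactly one of
  -- (J < l and I ≤ r) or (J ≥ l and I > r). The two alternatives are mutually
  -- exclusive (J < l vs J ≥ l), so "exactly one" is the disjunction.
  StableSegment : ℤ → ℤ → Set
  StableSegment l r = l ≤ r × (∀ I J → Edge I J → (J < l × I ≤ r) ⊎ (l ≤ J × I > r))

{-# OPTIONS --safe #-}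
module Submission where

-- Since i and j are both increasing, the matching edges ending at most at r form a
-- prefix. If t* is the first edge with i t* > r, then l = min(r, j t*) separates every
-- matching edge: those before t* end by r and start below both r and j t*, those from
-- t* on start at or after j t* and end after r. Symmetrically, if t* is the last edge
-- with j t* < l, take r = max(l, i t*); when there is no such t*, the singleton works.
-- The unit edges (I, I-1) are separated by [l..r] whenever I ∉ (l..r], and since they
-- sit at I ≤ 1 or I > L this holds when l = r or when [l..r] ⊆ [1..L].

open import Defs
open import Data.Integer using (ℤ; _≤_)
open import Data.Product using (∃; _×_; _,_)

open import Data.Nat as ℕ using (zero; suc; s≤s; z≤n)
import Data.Nat.Properties as ℕP
open import Data.Fin as Fin using (Fin)
import Data.Fin.Properties as FinP
open import Data.Integer as ℤ using (+_; _-_; _<_; _>_; _⊓_; _⊔_; +≤+; +<+)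
open import Data.Integer.Properties
open import Data.Sum using (_⊎_; inj₁; inj₂)
open import Function using (_∘_)
open import Relation.Nullary using (¬_; yes; no)
open import Relation.Unary using (Pred; Decidable)
open import Relation.Binary.PropositionalEquality using (_≡_; refl; sym)

least-or-none : ∀ {n ℓ} {P : Pred (Fin n) ℓ} → Decidable P →
                (∀ t → ¬ P t) ⊎ ∃ λ t → P t × (∀ s → s Fin.< t → ¬ P s)
least-or-none {zero}  P? = inj₁ λ ()
least-or-none {suc n} P? with P? Fin.zero
... | yes p  = inj₂ (Fin.zero , p , λ _ ())
... | no ¬p with least-or-none (P? ∘ Fin.suc)
...   | inj₁ none = inj₁ λ { Fin.zero → ¬p ; (Fin.suc t) → none t }
...   | inj₂ (t , p , before) =
        inj₂ (Fin.suc t , p , λ { Fin.zero _ → ¬p ; (Fin.suc s) s<t → before s (ℕ.s<s⁻¹ s<t) })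

greatest-or-none : ∀ {n ℓ} {P : Pred (Fin n) ℓ} → Decidable P →
                   (∀ t → ¬ P t) ⊎ ∃ λ t → P t × (∀ s → t Fin.< s → ¬ P s)
greatest-or-none {zero}  P? = inj₁ λ ()
greatest-or-none {suc n} P? with greatest-or-none (P? ∘ Fin.suc)
... | inj₂ (t , p , after) =
      inj₂ (Fin.suc t , p , λ { Fin.zero () ; (Fin.suc s) t<s → after s (ℕ.s<s⁻¹ t<s) })
... | inj₁ none with P? Fin.zero
...   | yes p  = inj₂ (Fin.zero , p , λ { Fin.zero () ; (Fin.suc s) _ → none s })
...   | no ¬p = inj₁ λ { Fin.zero → ¬p ; (Fin.suc t) → none t }

strictMono⇒mono : ∀ {m n} {f : Fin m → Fin n} → (∀ s t → s Fin.< t → f s Fin.< f t) →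
                  ∀ {s t} → s Fin.≤ t → f s Fin.≤ f t
strictMono⇒mono f-mono {s} {t} s≤t with ℕP.m≤n⇒m<n∨m≡n s≤t
... | inj₁ s<t = ℕP.<⇒≤ (f-mono s t s<t)
... | inj₂ s≡t rewrite FinP.toℕ-injective {i = s} {j = t} s≡t = ℕP.≤-refl

pos-mono-< : ∀ {n} {s t : Fin n} → s Fin.< t → pos s < pos t
pos-mono-< s<t = +<+ (s≤s s<t)

pos-mono-≤ : ∀ {n} {s t : Fin n} → s Fin.≤ t → pos s ≤ pos t
pos-mono-≤ s≤t = +≤+ (s≤s s≤t)

1≤pos : ∀ {n} (s : Fin n) → + 1 ≤ pos s
1≤pos s = +≤+ (s≤s z≤n)

pos≤n : ∀ {n} (s : Fin n) → pos s ≤ + n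
pos≤n s = +≤+ (FinP.toℕ<n s)

<-⊓ : ∀ {x y z} → x < y → x < z → x < y ⊓ z
<-⊓ x<y x<z = suc[i]≤j⇒i<j (⊓-glb (i<j⇒suc[i]≤j x<y) (i<j⇒suc[i]≤j x<z))

⊔-< : ∀ {x y z} → y < x → z < x → y ⊔ z < x
⊔-< y<x z<x = i≤pred[j]⇒i<j (⊔-lub (i<j⇒i≤pred[j] y<x) (i<j⇒i≤pred[j] z<x))

Separated : ℤ → ℤ → ℤ → ℤ → Set
Separated l r I J = (J < l × I ≤ r) ⊎ (l ≤ J × I > r)

unit-edge-separated : ∀ {l r I} → l ≤ r → I ≤ l ⊎ r < I → Separated l r I (I - + 1)
unit-edge-separated {I = I} l≤r side
  -- I - + 1 is I + -1ℤ, whereas the pred lemmas are about -1ℤ + I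
  rewrite +-comm I (ℤ.- + 1) with side
... | inj₁ I≤l = inj₁ (<-≤-trans (i≤pred[j]⇒i<j ≤-refl) I≤l , ≤-trans I≤l l≤r)
... | inj₂ r<I = inj₂ (≤-trans l≤r (i<j⇒i≤pred[j] r<I) , r<I)

outside-segment : ∀ {l r a b I} → l ≡ r ⊎ (a ≤ l × r ≤ b) → I > b ⊎ I ≤ a → I ≤ l ⊎ r < I
outside-segment {r = r} {I = I} (inj₁ refl) _ with I ≤? r
... | yes I≤r = inj₁ I≤r
... | no I≰r  = inj₂ (≰⇒> I≰r)
outside-segment (inj₂ (_ , r≤b)) (inj₁ b<I) = inj₂ (≤-<-trans r≤b b<I)
outside-segment (inj₂ (a≤l , _)) (inj₂ I≤a) = inj₁ (≤-trans I≤a a≤l)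

module _ {Sym : Set} (S : Setting Sym) where
  open Setting S

  i′ j′ : Fin M → ℤ
  i′ t = pos (i t)
  j′ t = pos (j t)

  j′<i′ : ∀ t → j′ t < i′ t
  j′<i′ t = pos-mono-< (i>j t)

  stable-of-separated : ∀ {l r} → l ≤ r → l ≡ r ⊎ (+ 1 ≤ l × r ≤ + L) →
                        (∀ t → Separated l r (i′ t) (j′ t)) → StableSegment S l r
  stable-of-separated l≤r bounds sep = l≤r , separated
    where
    separated : ∀ I J → Edge S I J → Separated _ _ I J
    separated _ _ (inj₁ (t , refl , refl)) = sep t
    separated _ _ (inj₂ (boundary , refl)) =
      unit-edge-separated l≤r (outside-segment bounds boundary)

  stable-segment-ending-at : ∀ r → ∃ λ l → l ≤ r × StableSegment S l r
  stable-segment-ending-at r with least-or-none (λ t → r <? i′ t)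
  ... | inj₁ none = r , ≤-refl , stable-of-separated ≤-refl (inj₁ refl) separated
    where
    separated : ∀ t → Separated r r (i′ t) (j′ t)
    separated t = let i≤r = ≮⇒≥ (none t) in inj₁ (<-≤-trans (j′<i′ t) i≤r , i≤r)
  ... | inj₂ (t* , r<i* , before) = l , l≤r , stable-of-separated l≤r bounds separated
    where
    l : ℤ
    l = r ⊓ j′ t*
    l≤r : l ≤ r
    l≤r = i⊓j≤i r (j′ t*)
    bounds : l ≡ r ⊎ (+ 1 ≤ l × r ≤ + L)
    bounds with + 1 ≤? r
    ... | yes 1≤r = inj₂ (⊓-glb 1≤r (1≤pos (j t*)) , <⇒≤ (<-≤-trans r<i* (pos≤n (i t*))))
    ... | no 1≰r  = inj₁ (i≤j⇒i⊓j≡i (<⇒≤ (<-≤-trans (≰⇒> 1≰r) (1≤pos (j t*)))))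
    separated : ∀ t → Separated l r (i′ t) (j′ t)
    separated t with t Fin.<? t*
    ... | yes t<t* = let i≤r = ≮⇒≥ (before t t<t*) in
                     inj₁ (<-⊓ (<-≤-trans (j′<i′ t) i≤r) (pos-mono-< (j-mono t t* t<t*)) , i≤r)
    ... | no t≮t*  = let t*≤t = ℕP.≮⇒≥ t≮t* in
                     inj₂ (≤-trans (i⊓j≤j r (j′ t*)) (pos-mono-≤ (strictMono⇒mono j-mono t*≤t)) ,
                           <-≤-trans r<i* (pos-mono-≤ (strictMono⇒mono i-mono t*≤t)))

  stable-segment-starting-at : ∀ l → ∃ λ r → l ≤ r × StableSegment S l r
  stable-segment-starting-at l with greatest-or-none (λ t → j′ t <? l)
  ... | inj₁ none = l , ≤-refl , stable-of-separated ≤-refl (inj₁ refl) separated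
    where
    separated : ∀ t → Separated l l (i′ t) (j′ t)
    separated t = let l≤j = ≮⇒≥ (none t) in inj₂ (l≤j , ≤-<-trans l≤j (j′<i′ t))
  ... | inj₂ (t* , j*<l , after) = r , l≤r , stable-of-separated l≤r bounds separated
    where
    r : ℤ
    r = l ⊔ i′ t*
    l≤r : l ≤ r
    l≤r = i≤i⊔j l (i′ t*)
    bounds : l ≡ r ⊎ (+ 1 ≤ l × r ≤ + L)
    bounds with l ≤? + L
    ... | yes l≤L = inj₂ (≤-trans (1≤pos (j t*)) (<⇒≤ j*<l) , ⊔-lub l≤L (pos≤n (i t*)))
    ... | no l≰L  = inj₁ (sym (i≥j⇒i⊔j≡i (<⇒≤ (≤-<-trans (pos≤n (i t*)) (≰⇒> l≰L)))))
    separated : ∀ t → Separated l r (i′ t) (j′ t)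
    separated t with t* Fin.<? t
    ... | yes t*<t = let l≤j = ≮⇒≥ (after t t*<t) in
                     inj₂ (l≤j , ⊔-< (≤-<-trans l≤j (j′<i′ t)) (pos-mono-< (i-mono t* t t*<t)))
    ... | no t*≮t  = let t≤t* = ℕP.≮⇒≥ t*≮t in
                     inj₁ (≤-<-trans (pos-mono-≤ (strictMono⇒mono j-mono t≤t*)) j*<l ,
                           ≤-trans (pos-mono-≤ (strictMono⇒mono i-mono t≤t*)) (i≤j⊔i l (i′ t*)))

lemma4p3 : {Sym : Set} (S : Setting Sym)
    → ((r : ℤ) → ∃ λ l → l ≤ r × StableSegment S l r)
    × ((l : ℤ) → ∃ λ r → l ≤ r × StableSegment S l r)
lemma4p3 S = stable-segment-ending-at S , stable-segment-starting-at S
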